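{- In the $B$-sequent calculus described in the context, let $I$ be any rule other than weakening. For any application of $I$, if its conclusion is a valid $B$-sequent, then every premise of that application is a valid $B$-sequent.
   Context: Language $\mathcal{S}$: formulas built from propositional variables with $\neg$, $\wedge$, $\vee$. Truth values $\mathbf{4}=\{\mathbf{f},\bot,\top,\mathbf{t}\}$ with truth order $\leq_t$: $\mathbf{f}$ least, $\mathbf{t}$ greatest, $\bot,\top$ incomparable in between; $-_t$ swaps $\mathbf{t},\mathbf{f}$ and fixes $\bot,\top$; $\sqcap_t,\sqcup_t$ meet and join. An agent is a map $s:\mathcal{S}\to\mathbf{4}$ with $s(\neg\varphi)=-_ts(\varphi)$, $s(\varphi\wedge\psi)=s(\varphi)\sqcap_ts(\psi)$, $s(\varphi\vee\psi)=s(\varphi)\sqcup_ts(\psi)$. $s$ accepts $\varphi$ iff $s(\varphi)\in\{\top,\mathbf{t}\}$, not-accepts iff $s(\varphi)\in\{\mathbf{f},\bot\}$, rejects iff $s(\varphi)\in\{\mathbf{f},\top\}$, not-rejects iff $s(\varphi)\in\{\bot,\mathbf{t}\}$. A $B$-sequent is a quadruple $[\Gamma;\Psi;\Phi;\Delta]$ of finite sets of formulas; it is valid iff there is no agent that accepts all of $\Gamma$, not-rejects all of $\Psi$, rejects all of $\Phi$ and not-accepts all of $\Delta$. Below "$\alpha,\Gamma$" means $\{\alpha\}\cup\Gamma$. Rules (premises $\Rightarrow$ conclusion): Initial (no premises): $[\{\alpha\};\emptyset;\emptyset;\{\alpha\}]$ and $[\emptyset;\{\alpha\};\{\alpha\};\emptyset]$.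 Weakening: from $[\Gamma;\Psi;\Phi;\Delta]$ infer $[\Gamma\cup\Gamma';\Psi\cup\Psi';\Phi\cup\Phi';\Delta\cup\Delta']$. Cut$_t$: from $[\alpha,\Gamma;\Psi;\Phi;\Delta]$ and $[\Gamma;\Psi;\Phi;\Delta,\alpha]$ infer $[\Gamma;\Psi;\Phi;\Delta]$. Cut$_f$: from $[\Gamma;\alpha,\Psi;\Phi;\Delta]$ and $[\Gamma;\Psi;\Phi,\alpha;\Delta]$ infer $[\Gamma;\Psi;\Phi;\Delta]$. Conjunction: from $[\Gamma;\Psi;\Phi;\Delta,\alpha]$ and $[\Gamma;\Psi;\Phi;\Delta,\beta]$ infer $[\Gamma;\Psi;\Phi;\Delta,\alpha\wedge\beta]$; from $[\Gamma;\Psi;\Phi,\alpha;\Delta]$ and $[\Gamma;\Psi;\Phi,\beta;\Delta]$ infer $[\Gamma;\Psi;\Phi,\alpha\wedge\beta;\Delta]$; from $[\alpha,\beta,\Gamma;\Psi;\Phi;\Delta]$ infer $[\alpha\wedge\beta,\Gamma;\Psi;\Phi;\Delta]$; from $[\Gamma;\alpha,\beta,\Psi;\Phi;\Delta]$ infer $[\Gamma;\alpha\wedge\beta,\Psi;\Phi;\Delta]$. Disjunction: from $[\Gamma;\alpha,\Psi;\Phi;\Delta]$ and $[\Gamma;\beta,\Psi;\Phi;\Delta]$ infer $[\Gamma;\alpha\vee\beta,\Psi;\Phi;\Delta]$; from $[\alpha,\Gamma;\Psi;\Phi;\Delta]$ and $[\beta,\Gamma;\Psi;\Phi;\Delta]$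 infer $[\alpha\vee\beta,\Gamma;\Psi;\Phi;\Delta]$; from $[\Gamma;\Psi;\Phi,\alpha,\beta;\Delta]$ infer $[\Gamma;\Psi;\Phi,\alpha\vee\beta;\Delta]$; from $[\Gamma;\Psi;\Phi;\Delta,\alpha,\beta]$ infer $[\Gamma;\Psi;\Phi;\Delta,\alpha\vee\beta]$. Negation: from $[\Gamma;\Psi;\Phi,\alpha;\Delta]$ infer $[\neg\alpha,\Gamma;\Psi;\Phi;\Delta]$; from $[\Gamma;\Psi;\Phi;\Delta,\alpha]$ infer $[\Gamma;\neg\alpha,\Psi;\Phi;\Delta]$; from $[\alpha,\Gamma;\Psi;\Phi;\Delta]$ infer $[\Gamma;\Psi;\Phi,\neg\alpha;\Delta]$; from $[\Gamma;\alpha,\Psi;\Phi;\Delta]$ infer $[\Gamma;\Psi;\Phi;\Delta,\neg\alpha]$. -}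

module Defs where

open import Data.Nat using (ℕ)
open import Data.List using (List; []; _∷_)
open import Data.List.Relation.Unary.All using (All)
open import Data.Product using (Σ; _×_; _,_)
open import Relation.Binary.PropositionalEquality using (_≡_)
open import Relation.Nullary using (¬_)

data Formula : Set where
  var  : ℕ → Formula
  ¬'_  : Formula → Formula
  _∧'_ : Formula → Formula → Formula
  _∨'_ : Formula → Formula → Formula

data Four : Set where
  𝐟 ⊥₄ ⊤₄ 𝐭 : Four

-t_ : Four → Four
-t 𝐟  = 𝐭
-t ⊥₄ = ⊥₄
-t ⊤₄ = ⊤₄
-t 𝐭  = 𝐟

-- truth-order meet (f least, t greatest, ⊥ and ⊤ incomparable)
_⊓t_ : Four → Four → Four
𝐟  ⊓t y  = 𝐟
⊥₄ ⊓t 𝐟  = 𝐟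
⊥₄ ⊓t ⊥₄ = ⊥₄
⊥₄ ⊓t ⊤₄ = 𝐟
⊥₄ ⊓t 𝐭  = ⊥₄
⊤₄ ⊓t 𝐟  = 𝐟
⊤₄ ⊓t ⊥₄ = 𝐟
⊤₄ ⊓t ⊤₄ = ⊤₄
⊤₄ ⊓t 𝐭  = ⊤₄
𝐭  ⊓t y  = y

_⊔t_ : Four → Four → Four
𝐭  ⊔t y  = 𝐭
⊥₄ ⊔t 𝐭  = 𝐭
⊥₄ ⊔t ⊥₄ = ⊥₄
⊥₄ ⊔t ⊤₄ = 𝐭
⊥₄ ⊔t 𝐟  = ⊥₄
⊤₄ ⊔t 𝐭  = 𝐭
⊤₄ ⊔t ⊥₄ = 𝐭
⊤₄ ⊔t ⊤₄ = ⊤₄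
⊤₄ ⊔t 𝐟  = ⊤₄
𝐟  ⊔t y  = y

record Agent : Set where
  field
    val    : Formula → Four
    val-¬  : ∀ φ → val (¬' φ) ≡ -t (val φ)
    val-∧  : ∀ φ ψ → val (φ ∧' ψ) ≡ val φ ⊓t val ψ
    val-∨  : ∀ φ ψ → val (φ ∨' ψ) ≡ val φ ⊔t val ψ
open Agent public

data Acc : Four → Set where
  acc-⊤ : Acc ⊤₄
  acc-t : Acc 𝐭

data NotAcc : Four → Set where
  nacc-f : NotAcc 𝐟
  nacc-⊥ : NotAcc ⊥₄

data Rej : Four → Set where
  rej-f : Rej 𝐟
  rej-⊤ : Rej ⊤₄

data NotRej : Four → Set where
  nrej-⊥ : NotRej ⊥₄
  nrej-t : NotRej 𝐭

accepts notAccepts rejects notRejects : Agent → Formula → Set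
accepts    s φ = Acc    (val s φ)
notAccepts s φ = NotAcc (val s φ)
rejects    s φ = Rej    (val s φ)
notRejects s φ = NotRej (val s φ)

-- B-sequents [Γ;Ψ;Φ;Δ]; finite sets represented by lists
-- (all notions below depend only on membership).
record BSeq : Set where
  constructor [_⨾_⨾_⨾_]
  field
    Γ Ψ Φ Δ : List Formula

Refutes : Agent → BSeq → Set
Refutes s [ Γ ⨾ Ψ ⨾ Φ ⨾ Δ ] =
  All (accepts s) Γ × All (notRejects s) Ψ × All (rejects s) Φ × All (notAccepts s) Δ

Valid : BSeq → Set
Valid S = ¬ (Σ Agent λ s → Refutes s S)

-- Applications of the rules OTHER THAN weakening:
-- RuleApp premises conclusion.  "α,Γ" = {α} ∪ Γ is written α ∷ Γ.
data RuleApp : List BSeq → BSeq → Set where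
  init₁ : ∀ α → RuleApp [] [ α ∷ [] ⨾ [] ⨾ [] ⨾ α ∷ [] ]
  init₂ : ∀ α → RuleApp [] [ [] ⨾ α ∷ [] ⨾ α ∷ [] ⨾ [] ]
  cut-t : ∀ α Γ Ψ Φ Δ →
    RuleApp ([ α ∷ Γ ⨾ Ψ ⨾ Φ ⨾ Δ ] ∷ [ Γ ⨾ Ψ ⨾ Φ ⨾ α ∷ Δ ] ∷ []) [ Γ ⨾ Ψ ⨾ Φ ⨾ Δ ]
  cut-f : ∀ α Γ Ψ Φ Δ →
    RuleApp ([ Γ ⨾ α ∷ Ψ ⨾ Φ ⨾ Δ ] ∷ [ Γ ⨾ Ψ ⨾ α ∷ Φ ⨾ Δ ] ∷ []) [ Γ ⨾ Ψ ⨾ Φ ⨾ Δ ]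
  ∧-Δ : ∀ α β Γ Ψ Φ Δ →
    RuleApp ([ Γ ⨾ Ψ ⨾ Φ ⨾ α ∷ Δ ] ∷ [ Γ ⨾ Ψ ⨾ Φ ⨾ β ∷ Δ ] ∷ []) [ Γ ⨾ Ψ ⨾ Φ ⨾ (α ∧' β) ∷ Δ ]
  ∧-Φ : ∀ α β Γ Ψ Φ Δ →
    RuleApp ([ Γ ⨾ Ψ ⨾ α ∷ Φ ⨾ Δ ] ∷ [ Γ ⨾ Ψ ⨾ β ∷ Φ ⨾ Δ ] ∷ []) [ Γ ⨾ Ψ ⨾ (α ∧' β) ∷ Φ ⨾ Δ ]
  ∧-Γ : ∀ α β Γ Ψ Φ Δ →
    RuleApp ([ α ∷ β ∷ Γ ⨾ Ψ ⨾ Φ ⨾ Δ ] ∷ []) [ (α ∧' β) ∷ Γ ⨾ Ψ ⨾ Φ ⨾ Δ ]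
  ∧-Ψ : ∀ α β Γ Ψ Φ Δ →
    RuleApp ([ Γ ⨾ α ∷ β ∷ Ψ ⨾ Φ ⨾ Δ ] ∷ []) [ Γ ⨾ (α ∧' β) ∷ Ψ ⨾ Φ ⨾ Δ ]
  ∨-Ψ : ∀ α β Γ Ψ Φ Δ →
    RuleApp ([ Γ ⨾ α ∷ Ψ ⨾ Φ ⨾ Δ ] ∷ [ Γ ⨾ β ∷ Ψ ⨾ Φ ⨾ Δ ] ∷ []) [ Γ ⨾ (α ∨' β) ∷ Ψ ⨾ Φ ⨾ Δ ]
  ∨-Γ : ∀ α β Γ Ψ Φ Δ →
    RuleApp ([ α ∷ Γ ⨾ Ψ ⨾ Φ ⨾ Δ ] ∷ [ β ∷ Γ ⨾ Ψ ⨾ Φ ⨾ Δ ] ∷ []) [ (α ∨' β) ∷ Γ ⨾ Ψ ⨾ Φ ⨾ Δ ]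
  ∨-Φ : ∀ α β Γ Ψ Φ Δ →
    RuleApp ([ Γ ⨾ Ψ ⨾ α ∷ β ∷ Φ ⨾ Δ ] ∷ []) [ Γ ⨾ Ψ ⨾ (α ∨' β) ∷ Φ ⨾ Δ ]
  ∨-Δ : ∀ α β Γ Ψ Φ Δ →
    RuleApp ([ Γ ⨾ Ψ ⨾ Φ ⨾ α ∷ β ∷ Δ ] ∷ []) [ Γ ⨾ Ψ ⨾ Φ ⨾ (α ∨' β) ∷ Δ ]
  ¬-Γ : ∀ α Γ Ψ Φ Δ →
    RuleApp ([ Γ ⨾ Ψ ⨾ α ∷ Φ ⨾ Δ ] ∷ []) [ (¬' α) ∷ Γ ⨾ Ψ ⨾ Φ ⨾ Δ ]
  ¬-Ψ : ∀ α Γ Ψ Φ Δ →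
    RuleApp ([ Γ ⨾ Ψ ⨾ Φ ⨾ α ∷ Δ ] ∷ []) [ Γ ⨾ (¬' α) ∷ Ψ ⨾ Φ ⨾ Δ ]
  ¬-Φ : ∀ α Γ Ψ Φ Δ →
    RuleApp ([ α ∷ Γ ⨾ Ψ ⨾ Φ ⨾ Δ ] ∷ []) [ Γ ⨾ Ψ ⨾ (¬' α) ∷ Φ ⨾ Δ ]
  ¬-Δ : ∀ α Γ Ψ Φ Δ →
    RuleApp ([ Γ ⨾ α ∷ Ψ ⨾ Φ ⨾ Δ ] ∷ []) [ Γ ⨾ Ψ ⨾ Φ ⨾ (¬' α) ∷ Δ ]

-- Every agent refuting a premise of a non-weakening rule refutes its conclusion as well.
-- A cut premise only extends the conclusion by one formula, and for a logical rule the
-- condition a premise imposes on the components forces the matching condition on the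
-- principal formula, by the truth tables of -t, ⊓t and ⊔t. So a valid conclusion has no
-- countermodel, and neither has any premise.
module Submission where

open import Defs
open import Data.List using (List; []; _∷_)
open import Data.List.Relation.Unary.All as All using (All; []; _∷_)
open import Data.Product using (_,_)
open import Relation.Binary.PropositionalEquality using (subst; sym)

NotAcc-⊓ˡ : ∀ {a b} → NotAcc a → NotAcc (a ⊓t b)
NotAcc-⊓ˡ         nacc-f = nacc-f
NotAcc-⊓ˡ {b = 𝐟}  nacc-⊥ = nacc-f
NotAcc-⊓ˡ {b = ⊥₄} nacc-⊥ = nacc-⊥
NotAcc-⊓ˡ {b = ⊤₄} nacc-⊥ = nacc-f
NotAcc-⊓ˡ {b = 𝐭}  nacc-⊥ = nacc-⊥

NotAcc-⊓ʳ : ∀ {a b} → NotAcc b → NotAcc (a ⊓t b)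
NotAcc-⊓ʳ {𝐟}  _      = nacc-f
NotAcc-⊓ʳ {⊥₄} nacc-f = nacc-f
NotAcc-⊓ʳ {⊥₄} nacc-⊥ = nacc-⊥
NotAcc-⊓ʳ {⊤₄} nacc-f = nacc-f
NotAcc-⊓ʳ {⊤₄} nacc-⊥ = nacc-f
NotAcc-⊓ʳ {𝐭}  p      = p

Rej-⊓ˡ : ∀ {a b} → Rej a → Rej (a ⊓t b)
Rej-⊓ˡ         rej-f = rej-f
Rej-⊓ˡ {b = 𝐟}  rej-⊤ = rej-f
Rej-⊓ˡ {b = ⊥₄} rej-⊤ = rej-f
Rej-⊓ˡ {b = ⊤₄} rej-⊤ = rej-⊤
Rej-⊓ˡ {b = 𝐭}  rej-⊤ = rej-⊤

Rej-⊓ʳ : ∀ {a b} → Rej b → Rej (a ⊓t b)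
Rej-⊓ʳ {𝐟}  _     = rej-f
Rej-⊓ʳ {⊥₄} rej-f = rej-f
Rej-⊓ʳ {⊥₄} rej-⊤ = rej-f
Rej-⊓ʳ {⊤₄} rej-f = rej-f
Rej-⊓ʳ {⊤₄} rej-⊤ = rej-⊤
Rej-⊓ʳ {𝐭}  q     = q

Acc-⊓ : ∀ {a b} → Acc a → Acc b → Acc (a ⊓t b)
Acc-⊓ acc-⊤ acc-⊤ = acc-⊤
Acc-⊓ acc-⊤ acc-t = acc-⊤
Acc-⊓ acc-t q     = q

NotRej-⊓ : ∀ {a b} → NotRej a → NotRej b → NotRej (a ⊓t b)
NotRej-⊓ nrej-⊥ nrej-⊥ = nrej-⊥
NotRej-⊓ nrej-⊥ nrej-t = nrej-⊥
NotRej-⊓ nrej-t q      = q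

NotRej-⊔ˡ : ∀ {a b} → NotRej a → NotRej (a ⊔t b)
NotRej-⊔ˡ         nrej-t = nrej-t
NotRej-⊔ˡ {b = 𝐟}  nrej-⊥ = nrej-⊥
NotRej-⊔ˡ {b = ⊥₄} nrej-⊥ = nrej-⊥
NotRej-⊔ˡ {b = ⊤₄} nrej-⊥ = nrej-t
NotRej-⊔ˡ {b = 𝐭}  nrej-⊥ = nrej-t

NotRej-⊔ʳ : ∀ {a b} → NotRej b → NotRej (a ⊔t b)
NotRej-⊔ʳ {𝐭}  _      = nrej-t
NotRej-⊔ʳ {⊥₄} nrej-t = nrej-t
NotRej-⊔ʳ {⊥₄} nrej-⊥ = nrej-⊥
NotRej-⊔ʳ {⊤₄} nrej-t = nrej-t
NotRej-⊔ʳ {⊤₄} nrej-⊥ = nrej-t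
NotRej-⊔ʳ {𝐟}  q      = q

Acc-⊔ˡ : ∀ {a b} → Acc a → Acc (a ⊔t b)
Acc-⊔ˡ         acc-t = acc-t
Acc-⊔ˡ {b = 𝐟}  acc-⊤ = acc-⊤
Acc-⊔ˡ {b = ⊥₄} acc-⊤ = acc-t
Acc-⊔ˡ {b = ⊤₄} acc-⊤ = acc-⊤
Acc-⊔ˡ {b = 𝐭}  acc-⊤ = acc-t

Acc-⊔ʳ : ∀ {a b} → Acc b → Acc (a ⊔t b)
Acc-⊔ʳ {𝐭}  _     = acc-t
Acc-⊔ʳ {⊥₄} acc-t = acc-t
Acc-⊔ʳ {⊥₄} acc-⊤ = acc-t
Acc-⊔ʳ {⊤₄} acc-t = acc-t
Acc-⊔ʳ {⊤₄} acc-⊤ = acc-⊤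
Acc-⊔ʳ {𝐟}  q     = q

Rej-⊔ : ∀ {a b} → Rej a → Rej b → Rej (a ⊔t b)
Rej-⊔ rej-f q     = q
Rej-⊔ rej-⊤ rej-f = rej-⊤
Rej-⊔ rej-⊤ rej-⊤ = rej-⊤

NotAcc-⊔ : ∀ {a b} → NotAcc a → NotAcc b → NotAcc (a ⊔t b)
NotAcc-⊔ nacc-f q      = q
NotAcc-⊔ nacc-⊥ nacc-f = nacc-⊥
NotAcc-⊔ nacc-⊥ nacc-⊥ = nacc-⊥

Rej⇒Acc-t : ∀ {a} → Rej a → Acc (-t a)
Rej⇒Acc-t rej-f = acc-t
Rej⇒Acc-t rej-⊤ = acc-⊤

NotAcc⇒NotRej-t : ∀ {a} → NotAcc a → NotRej (-t a)
NotAcc⇒NotRej-t nacc-f = nrej-t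
NotAcc⇒NotRej-t nacc-⊥ = nrej-⊥

Acc⇒Rej-t : ∀ {a} → Acc a → Rej (-t a)
Acc⇒Rej-t acc-⊤ = rej-⊤
Acc⇒Rej-t acc-t = rej-f

NotRej⇒NotAcc-t : ∀ {a} → NotRej a → NotAcc (-t a)
NotRej⇒NotAcc-t nrej-⊥ = nacc-⊥
NotRej⇒NotAcc-t nrej-t = nacc-f

module _ (s : Agent) {α β : Formula} where

  notAccepts-∧ˡ : notAccepts s α → notAccepts s (α ∧' β)
  notAccepts-∧ˡ p = subst NotAcc (sym (val-∧ s α β)) (NotAcc-⊓ˡ p)

  notAccepts-∧ʳ : notAccepts s β → notAccepts s (α ∧' β)
  notAccepts-∧ʳ p = subst NotAcc (sym (val-∧ s α β)) (NotAcc-⊓ʳ p)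

  rejects-∧ˡ : rejects s α → rejects s (α ∧' β)
  rejects-∧ˡ p = subst Rej (sym (val-∧ s α β)) (Rej-⊓ˡ p)

  rejects-∧ʳ : rejects s β → rejects s (α ∧' β)
  rejects-∧ʳ p = subst Rej (sym (val-∧ s α β)) (Rej-⊓ʳ p)

  accepts-∧ : accepts s α → accepts s β → accepts s (α ∧' β)
  accepts-∧ p q = subst Acc (sym (val-∧ s α β)) (Acc-⊓ p q)

  notRejects-∧ : notRejects s α → notRejects s β → notRejects s (α ∧' β)
  notRejects-∧ p q = subst NotRej (sym (val-∧ s α β)) (NotRej-⊓ p q)

  notRejects-∨ˡ : notRejects s α → notRejects s (α ∨' β)
  notRejects-∨ˡ p = subst NotRej (sym (val-∨ s α β)) (NotRej-⊔ˡ p)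

  notRejects-∨ʳ : notRejects s β → notRejects s (α ∨' β)
  notRejects-∨ʳ p = subst NotRej (sym (val-∨ s α β)) (NotRej-⊔ʳ p)

  accepts-∨ˡ : accepts s α → accepts s (α ∨' β)
  accepts-∨ˡ p = subst Acc (sym (val-∨ s α β)) (Acc-⊔ˡ p)

  accepts-∨ʳ : accepts s β → accepts s (α ∨' β)
  accepts-∨ʳ p = subst Acc (sym (val-∨ s α β)) (Acc-⊔ʳ p)

  rejects-∨ : rejects s α → rejects s β → rejects s (α ∨' β)
  rejects-∨ p q = subst Rej (sym (val-∨ s α β)) (Rej-⊔ p q)

  notAccepts-∨ : notAccepts s α → notAccepts s β → notAccepts s (α ∨' β)
  notAccepts-∨ p q = subst NotAcc (sym (val-∨ s α β)) (NotAcc-⊔ p q)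

module _ (s : Agent) {α : Formula} where

  rejects⇒accepts-¬ : rejects s α → accepts s (¬' α)
  rejects⇒accepts-¬ p = subst Acc (sym (val-¬ s α)) (Rej⇒Acc-t p)

  notAccepts⇒notRejects-¬ : notAccepts s α → notRejects s (¬' α)
  notAccepts⇒notRejects-¬ p = subst NotRej (sym (val-¬ s α)) (NotAcc⇒NotRej-t p)

  accepts⇒rejects-¬ : accepts s α → rejects s (¬' α)
  accepts⇒rejects-¬ p = subst Rej (sym (val-¬ s α)) (Acc⇒Rej-t p)

  notRejects⇒notAccepts-¬ : notRejects s α → notAccepts s (¬' α)
  notRejects⇒notAccepts-¬ p = subst NotAcc (sym (val-¬ s α)) (NotRej⇒NotAcc-t p)

RefutationsLift : BSeq → BSeq → Set
RefutationsLift P C = ∀ s → Refutes s P → Refutes s C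

ruleApp-liftsRefutations : ∀ {premises conclusion} →
  RuleApp premises conclusion → All (λ P → RefutationsLift P conclusion) premises
ruleApp-liftsRefutations (init₁ α) = []
ruleApp-liftsRefutations (init₂ α) = []
ruleApp-liftsRefutations (cut-t α Γ Ψ Φ Δ) =
  (λ { s (_ ∷ g , p , f , d) → g , p , f , d }) ∷
  (λ { s (g , p , f , _ ∷ d) → g , p , f , d }) ∷ []
ruleApp-liftsRefutations (cut-f α Γ Ψ Φ Δ) =
  (λ { s (g , _ ∷ p , f , d) → g , p , f , d }) ∷
  (λ { s (g , p , _ ∷ f , d) → g , p , f , d }) ∷ []
ruleApp-liftsRefutations (∧-Δ α β Γ Ψ Φ Δ) =
  (λ { s (g , p , f , x ∷ d) → g , p , f , notAccepts-∧ˡ s x ∷ d }) ∷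
  (λ { s (g , p , f , x ∷ d) → g , p , f , notAccepts-∧ʳ s x ∷ d }) ∷ []
ruleApp-liftsRefutations (∧-Φ α β Γ Ψ Φ Δ) =
  (λ { s (g , p , x ∷ f , d) → g , p , rejects-∧ˡ s x ∷ f , d }) ∷
  (λ { s (g , p , x ∷ f , d) → g , p , rejects-∧ʳ s x ∷ f , d }) ∷ []
ruleApp-liftsRefutations (∧-Γ α β Γ Ψ Φ Δ) =
  (λ { s (x ∷ y ∷ g , p , f , d) → accepts-∧ s x y ∷ g , p , f , d }) ∷ []
ruleApp-liftsRefutations (∧-Ψ α β Γ Ψ Φ Δ) =
  (λ { s (g , x ∷ y ∷ p , f , d) → g , notRejects-∧ s x y ∷ p , f , d }) ∷ []
ruleApp-liftsRefutations (∨-Ψ α β Γ Ψ Φ Δ) =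
  (λ { s (g , x ∷ p , f , d) → g , notRejects-∨ˡ s x ∷ p , f , d }) ∷
  (λ { s (g , x ∷ p , f , d) → g , notRejects-∨ʳ s x ∷ p , f , d }) ∷ []
ruleApp-liftsRefutations (∨-Γ α β Γ Ψ Φ Δ) =
  (λ { s (x ∷ g , p , f , d) → accepts-∨ˡ s x ∷ g , p , f , d }) ∷
  (λ { s (x ∷ g , p , f , d) → accepts-∨ʳ s x ∷ g , p , f , d }) ∷ []
ruleApp-liftsRefutations (∨-Φ α β Γ Ψ Φ Δ) =
  (λ { s (g , p , x ∷ y ∷ f , d) → g , p , rejects-∨ s x y ∷ f , d }) ∷ []
ruleApp-liftsRefutations (∨-Δ α β Γ Ψ Φ Δ) =
  (λ { s (g , p , f , x ∷ y ∷ d) → g , p , f , notAccepts-∨ s x y ∷ d }) ∷ []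
ruleApp-liftsRefutations (¬-Γ α Γ Ψ Φ Δ) =
  (λ { s (g , p , x ∷ f , d) → rejects⇒accepts-¬ s x ∷ g , p , f , d }) ∷ []
ruleApp-liftsRefutations (¬-Ψ α Γ Ψ Φ Δ) =
  (λ { s (g , p , f , x ∷ d) → g , notAccepts⇒notRejects-¬ s x ∷ p , f , d }) ∷ []
ruleApp-liftsRefutations (¬-Φ α Γ Ψ Φ Δ) =
  (λ { s (x ∷ g , p , f , d) → g , p , accepts⇒rejects-¬ s x ∷ f , d }) ∷ []
ruleApp-liftsRefutations (¬-Δ α Γ Ψ Φ Δ) =
  (λ { s (g , x ∷ p , f , d) → g , p , f , notRejects⇒notAccepts-¬ s x ∷ d }) ∷ []

valid-reflected : ∀ {P C} → RefutationsLift P C → Valid C → Valid P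
valid-reflected lift validC (s , refutesP) = validC (s , lift s refutesP)

mainTheorem4 : ∀ (premises : List BSeq) (conclusion : BSeq) →
    RuleApp premises conclusion → Valid conclusion → All Valid premises
mainTheorem4 _ _ rule validConclusion =
  All.map (λ lift → valid-reflected lift validConclusion) (ruleApp-liftsRefutations rule)
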